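{- Let $G=(V,E)$ be a connected simple graph. Let $\mathcal{F}$ be the collection of all edge sets $F\subseteq E$ such that the spanning subgraph $(V,F)$ contains a spanning tree of $G$ and $F$ is not over-braced. Then $\mathcal{F}$ satisfies the symmetric exchange axiom: for all $F_1,F_2\in\mathcal{F}$ and every $x\in F_1\triangle F_2$, there exists $y\in F_1\triangle F_2$ (possibly $y=x$) such that $F_1\triangle\{x,y\}\in\mathcal{F}$.
   Context: For $F'\subseteq E$, $V(F')$ denotes the set of endpoints of edges in $F'$. An edge set $F\subseteq E$ is over-braced if some non-empty subset $F'\subseteq F$ satisfies $|F'|>2|V(F')|-3$; the sets that are not over-braced are exactly the independent sets of the $2$-dimensional generic rigidity matroid of $G$. $\triangle$ denotes symmetric difference. -}

module Defs where

open import Data.Nat using (ℕ; _+_; _*_; _<_; _≥_)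
open import Data.Fin using (Fin)
open import Data.Fin.Subset using (Subset; _∈_; _⊆_; ⁅_⁆; _∪_; ⋃; ∣_∣; Nonempty; ⊤)
open import Data.Fin.Subset.Properties using (_∈?_)
open import Data.Vec using (zipWith)
open import Data.Bool using (_xor_)
open import Data.List using (List; []; _∷_; map; filter; length; _∷ʳ_)
open import Data.List.Relation.Unary.Linked using (Linked)
open import Data.List.Relation.Unary.Unique.Propositional using (Unique)
open import Data.Product using (_×_; Σ; ∃; ∃-syntax; proj₁; proj₂; _,_)
open import Data.Sum using (_⊎_)
open import Relation.Binary.PropositionalEquality using (_≡_; _≢_)
open import Relation.Binary.Construct.Closure.ReflexiveTransitive using (Star)
open import Relation.Nullary using (¬_)
open import Data.Vec using (allFin)
import Data.Vec as Vec

record Graph : Set where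
  field
    n     : ℕ
    m     : ℕ
    ends  : Fin m → Fin n × Fin n
    loopless : ∀ e → proj₁ (ends e) ≢ proj₂ (ends e)
    noParallel : ∀ e f →
      (ends e ≡ ends f ⊎ (proj₁ (ends e) ≡ proj₂ (ends f) × proj₂ (ends e) ≡ proj₁ (ends f))) →
      e ≡ f

module _ (G : Graph) where
  open Graph G

  EdgeSet : Set
  EdgeSet = Subset m

  endSet : Fin m → Subset n
  endSet e = ⁅ proj₁ (ends e) ⁆ ∪ ⁅ proj₂ (ends e) ⁆

  V : EdgeSet → Subset n
  V F = ⋃ (map endSet (filter (_∈? F) (Vec.toList (allFin m))))

  -- over-braced: some non-empty F' ⊆ F with |F'| > 2|V(F')| - 3
  -- (written |F'| + 3 > 2|V(F')| to avoid truncated subtraction)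
  OverBraced : EdgeSet → Set
  OverBraced F = ∃[ F' ] (F' ⊆ F × Nonempty F' × 2 * ∣ V F' ∣ < ∣ F' ∣ + 3)

  Adj : EdgeSet → Fin n → Fin n → Set
  Adj F u v = ∃[ e ] (e ∈ F × (ends e ≡ (u , v) ⊎ ends e ≡ (v , u)))

  Connected : EdgeSet → Set
  Connected F = ∀ u v → Star (Adj F) u v

  HasCycle : EdgeSet → Set
  HasCycle F = ∃[ v ] ∃[ ws ]
    (2 Data.Nat.≤ length ws × Unique (v ∷ ws) × Linked (Adj F) ((v ∷ ws) ∷ʳ v))

  SpanningTree : EdgeSet → Set
  SpanningTree T = Connected T × ¬ HasCycle T

  ContainsSpanningTree : EdgeSet → Set
  ContainsSpanningTree F = ∃[ T ] (T ⊆ F × SpanningTree T)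

  InF : EdgeSet → Set
  InF F = ContainsSpanningTree F × ¬ OverBraced F

_△_ : ∀ {k} → Subset k → Subset k → Subset k
A △ B = zipWith _xor_ A B

ConnectedGraph : Graph → Set
ConnectedGraph G = Connected G ⊤

-- For x ∉ F₁, add x to F₁. If F₁ ∪ {x} is not over-braced, y = x works. Otherwise every
-- over-braced subset of F₁ ∪ {x} contains x, and by submodularity of |V(·)| the intersection
-- of two of them is again over-braced; so removing any edge y of a minimum one, S, gives an
-- independent set, and as F₂ is independent we can choose y ∉ F₂. Connectivity survives:
-- a cut crossed by y alone would split S ∖ {y} into two sides A, B, each with
-- |A| + 2 ≤ 2|V(A)| on its own colour class, forcing |S| + 3 ≤ 2|V(S)|.
-- For x ∈ F₁, delete x. If F₁ ∖ {x} stays connected, y = x works. Otherwise F₁ ∖ {x} has a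
-- cut, F₂ crosses it at some y ∉ F₁, and adding y preserves independence by the same
-- splitting count, and connectivity because x was the only edge of F₁ across the cut.

module Submission where

open import Defs
open import Data.Fin.Subset using (_∈_; _∪_; ⁅_⁆)
open import Data.Product using (_×_; ∃-syntax)

open import Data.Bool using (Bool; true; false; not; _xor_)
import Data.Bool as Bool
open import Data.Bool.Properties
  using (¬-not; not-involutive; not-distribˡ-xor; not-distribʳ-xor; xor-assoc; xor-same; xor-identityʳ)
open import Data.Empty using (⊥-elim)
open import Data.Fin using (Fin; _≟_)
import Data.Fin as Fin
open import Data.Fin.Properties using (any?)
open import Data.Fin.Subset
  using (Subset; _∉_; _⊆_; _⊈_; _∩_; _─_; _-_; ⋃; ∣_∣; Nonempty; Empty; ⊥)
open import Data.Fin.Subset.Properties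
open import Data.Nat using (ℕ; zero; suc; _+_; _*_; _≤_; _<_; s≤s; z≤n; _<?_)
open import Data.Nat.Properties hiding (_≟_)
open import Data.Nat.Tactic.RingSolver using (solve-∀)
open import Data.Product using (_,_; proj₁; proj₂; swap; <_,_>)
open import Data.Product.Properties using (,-injectiveˡ; ,-injectiveʳ)
open import Data.Sum using (_⊎_; inj₁; inj₂; [_,_]′)
open import Data.Unit using (⊤; tt)
open import Data.List using (List; []; _∷_; _∷ʳ_; map; filter)
open import Data.List.Relation.Unary.All using (All; []; _∷_)
import Data.List.Relation.Unary.All as All
open import Data.List.Relation.Unary.AllPairs using (_∷_)
open import Data.List.Relation.Unary.Linked using (Linked; [-]; _∷_)
open import Data.List.Membership.Propositional using () renaming (_∈_ to _∈ₗ_)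
open import Data.List.Membership.Propositional.Properties using (∈-map∘filter⁻; ∈-map∘filter⁺)
open import Data.List.Relation.Unary.Any using (here; there)
open import Data.Vec using ([]; _∷_; here; there; lookup; tabulate; allFin)
import Data.Vec as Vec
open import Data.Vec.Membership.Propositional.Properties using (∈-toList⁺; ∈-allFin⁺)
open import Data.Vec.Properties using ([]=⇒lookup; lookup⇒[]=; lookup∘tabulate)
open import Function using (_∘_; id)
open import Relation.Binary.PropositionalEquality
open import Relation.Nullary using (¬_; Dec; yes; no)
open import Relation.Nullary.Decidable using (_×-dec_; ¬?; decidable-stable)
open import Relation.Binary.Construct.Closure.ReflexiveTransitive using (Star; ε; _◅_; _◅◅_)
import Relation.Binary.Construct.Closure.ReflexiveTransitive as Star
open import Relation.Unary using (Pred; Decidable)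

xor-cancelʳ : ∀ x y → (x xor y) xor y ≡ x
xor-cancelʳ x y = trans (xor-assoc x y y) (trans (cong (x xor_) (xor-same y)) (xor-identityʳ x))

xor-≢-≡ : ∀ {a b a′ b′} → a ≢ b → a′ ≡ b′ → a xor a′ ≢ b xor b′
xor-≢-≡ {a} {b} {a′} a≢b refl eq =
  a≢b (trans (sym (xor-cancelʳ a a′)) (trans (cong (_xor a′) eq) (xor-cancelʳ b a′)))

xor-≢-≢ : ∀ {a b a′ b′} → a ≢ b → a′ ≢ b′ → a xor a′ ≡ b xor b′
xor-≢-≢ {a} {b} {a′} {b′} a≢b a′≢b′ = begin
  a xor a′              ≡⟨ cong₂ _xor_ (¬-not a≢b) (¬-not a′≢b′) ⟩
  not b xor not b′      ≡⟨ sym (not-distribˡ-xor b (not b′)) ⟩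
  not (b xor not b′)    ≡⟨ cong not (sym (not-distribʳ-xor b b′)) ⟩
  not (not (b xor b′))  ≡⟨ not-involutive (b xor b′) ⟩
  b xor b′              ∎
  where open ≡-Reasoning

,-injective : ∀ {a b} {A : Set a} {B : Set b} {x x′ : A} {y y′ : B} →
              (x , y) ≡ (x′ , y′) → x ≡ x′ × y ≡ y′
,-injective = < ,-injectiveˡ , ,-injectiveʳ >

<+3⇒≤+2 : ∀ {a b} → a < b + 3 → a ≤ b + 2
<+3⇒≤+2 {a} {b} a<b+3 = ≤-pred (subst (a <_) (+-suc b 2) a<b+3)

≤+2⇒<+3 : ∀ {a b} → a ≤ b + 2 → a < b + 3
≤+2⇒<+3 {a} {b} a≤b+2 = subst (a <_) (sym (+-suc b 2)) (s≤s a≤b+2)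

[a+2]+[b+2]≡[a+b]+4 : ∀ a b → (a + 2) + (b + 2) ≡ (a + b) + 4
[a+2]+[b+2]≡[a+b]+4 = solve-∀

-- Finite sets

x∈p△q⁻ : ∀ {k} (p q : Subset k) {x} → x ∈ p △ q → (x ∈ p × x ∉ q) ⊎ (x ∉ p × x ∈ q)
x∈p△q⁻ (true  ∷ p) (false ∷ q) here       = inj₁ (here , λ ())
x∈p△q⁻ (false ∷ p) (true  ∷ q) here       = inj₂ ((λ ()) , here)
x∈p△q⁻ (_ ∷ p)     (_ ∷ q)     (there x∈) with x∈p△q⁻ p q x∈
... | inj₁ (x∈p , x∉q) = inj₁ (there x∈p , x∉q ∘ drop-there)
... | inj₂ (x∉p , x∈q) = inj₂ (x∉p ∘ drop-there , there x∈q)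

x∈p△q⁺ : ∀ {k} {p q : Subset k} {x} → (x ∈ p × x ∉ q) ⊎ (x ∉ p × x ∈ q) → x ∈ p △ q
x∈p△q⁺ {q = false ∷ q} (inj₁ (here , _))         = here
x∈p△q⁺ {q = true  ∷ q} (inj₁ (here , x∉q))       = ⊥-elim (x∉q here)
x∈p△q⁺ {p = false ∷ p} (inj₂ (_ , here))         = here
x∈p△q⁺ {p = true  ∷ p} (inj₂ (x∉p , here))       = ⊥-elim (x∉p here)
x∈p△q⁺ {q = _ ∷ q}     (inj₁ (there x∈p , x∉q)) = there (x∈p△q⁺ (inj₁ (x∈p , x∉q ∘ there)))
x∈p△q⁺ {p = _ ∷ p}     (inj₂ (x∉p , there x∈q)) = there (x∈p△q⁺ (inj₂ (x∉p ∘ there , x∈q)))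

x∈p─q⁻ : ∀ {k} (p q : Subset k) {x} → x ∈ p ─ q → x ∈ p × x ∉ q
x∈p─q⁻ (true  ∷ p) (false ∷ q) here       = here , λ ()
x∈p─q⁻ (true  ∷ p) (true  ∷ q) {Fin.zero} ()
x∈p─q⁻ (false ∷ p) (true  ∷ q) {Fin.zero} ()
x∈p─q⁻ (false ∷ p) (false ∷ q) {Fin.zero} ()
x∈p─q⁻ (_     ∷ p) (_     ∷ q) (there x∈) with x∈p─q⁻ p q x∈
... | x∈p , x∉q = there x∈p , x∉q ∘ drop-there

x∈p-y⁻ : ∀ {k} {p : Subset k} {x y} → x ∈ p - y → x ∈ p × x ≢ y
x∈p-y⁻ {p = p} {y = y} x∈ with x∈p─q⁻ p ⁅ y ⁆ x∈
... | x∈p , x∉⁅y⁆ = x∈p , x∉⁅y⁆⇒x≢y x∉⁅y⁆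

p⊆q⇒p-x⊆q-x : ∀ {k} {p q : Subset k} {x} → p ⊆ q → p - x ⊆ q - x
p⊆q⇒p-x⊆q-x p⊆q z∈ with x∈p-y⁻ z∈
... | z∈p , z≢x = x∈p∧x≢y⇒x∈p-y (p⊆q z∈p) z≢x

p⊆q∪⁅x⁆⇒p-x⊆q : ∀ {k} {p q : Subset k} {x} → p ⊆ q ∪ ⁅ x ⁆ → p - x ⊆ q
p⊆q∪⁅x⁆⇒p-x⊆q {q = q} {x} p⊆ z∈ with x∈p-y⁻ z∈
... | z∈p , z≢x with x∈p∪q⁻ q ⁅ x ⁆ (p⊆ z∈p)
...   | inj₁ z∈q  = z∈q
...   | inj₂ z∈⁅x⁆ = ⊥-elim (z≢x (x∈⁅y⁆⇒x≡y x z∈⁅x⁆))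

p⊆q∪⁅x⁆∧x∉p⇒p⊆q : ∀ {k} {p q : Subset k} {x} → p ⊆ q ∪ ⁅ x ⁆ → x ∉ p → p ⊆ q
p⊆q∪⁅x⁆∧x∉p⇒p⊆q p⊆ x∉p z∈ = p⊆q∪⁅x⁆⇒p-x⊆q p⊆ (x∈p∧x≢y⇒x∈p-y z∈ λ { refl → x∉p z∈ })

p⊈q⇒∃ : ∀ {k} {p q : Subset k} → p ⊈ q → ∃[ x ] (x ∈ p × x ∉ q)
p⊈q⇒∃ {p = p} {q} p⊈q with any? (λ x → x ∈? p ×-dec ¬? (x ∈? q))
... | yes witness = witness
... | no none = ⊥-elim (p⊈q λ {x} x∈p → decidable-stable (x ∈? q) λ x∉q → none (x , x∈p , x∉q))

x∈⋃⁻ : ∀ {k} (ps : List (Subset k)) {x} → x ∈ ⋃ ps → ∃[ p ] (p ∈ₗ ps × x ∈ p)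
x∈⋃⁻ []       x∈ = ⊥-elim (∉⊥ x∈)
x∈⋃⁻ (p ∷ ps) x∈ with x∈p∪q⁻ p (⋃ ps) x∈
... | inj₁ x∈p  = p , here refl , x∈p
... | inj₂ x∈⋃ with x∈⋃⁻ ps x∈⋃
...   | q , q∈ps , x∈q = q , there q∈ps , x∈q

x∈⋃⁺ : ∀ {k} {ps : List (Subset k)} {p x} → p ∈ₗ ps → x ∈ p → x ∈ ⋃ ps
x∈⋃⁺ (here refl) x∈p = x∈p∪q⁺ (inj₁ x∈p)
x∈⋃⁺ (there p∈) x∈p  = x∈p∪q⁺ (inj₂ (x∈⋃⁺ p∈ x∈p))

lookup≡false⇒∉ : ∀ {k} {p : Subset k} {x} → lookup p x ≡ false → x ∉ p
lookup≡false⇒∉ px≡false x∈p with () ← trans (sym px≡false) ([]=⇒lookup x∈p)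

x∈tabulate⁺ : ∀ {k} {f : Fin k → Bool} {x} → f x ≡ true → x ∈ tabulate f
x∈tabulate⁺ {f = f} {x} fx = lookup⇒[]= x (tabulate f) (trans (lookup∘tabulate f x) fx)

x∈tabulate⁻ : ∀ {k} {f : Fin k → Bool} {x} → x ∈ tabulate f → f x ≡ true
x∈tabulate⁻ {f = f} {x} x∈ = trans (sym (lookup∘tabulate f x)) ([]=⇒lookup x∈)

x∉tabulate⁺ : ∀ {k} {f : Fin k → Bool} {x} → f x ≡ false → x ∉ tabulate f
x∉tabulate⁺ fx≡false x∈ with () ← trans (sym fx≡false) (x∈tabulate⁻ x∈)

x∉tabulate⁻ : ∀ {k} {f : Fin k → Bool} {x} → x ∉ tabulate f → f x ≡ false
x∉tabulate⁻ x∉ = ¬-not (x∉ ∘ x∈tabulate⁺)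

∣p∪q∣+∣p∩q∣≡∣p∣+∣q∣ : ∀ {k} (p q : Subset k) → ∣ p ∪ q ∣ + ∣ p ∩ q ∣ ≡ ∣ p ∣ + ∣ q ∣
∣p∪q∣+∣p∩q∣≡∣p∣+∣q∣ []          []          = refl
∣p∪q∣+∣p∩q∣≡∣p∣+∣q∣ (true  ∷ p) (true  ∷ q) =
  cong suc (trans (+-suc _ _) (trans (cong suc (∣p∪q∣+∣p∩q∣≡∣p∣+∣q∣ p q)) (sym (+-suc _ _))))
∣p∪q∣+∣p∩q∣≡∣p∣+∣q∣ (true  ∷ p) (false ∷ q) = cong suc (∣p∪q∣+∣p∩q∣≡∣p∣+∣q∣ p q)
∣p∪q∣+∣p∩q∣≡∣p∣+∣q∣ (false ∷ p) (true  ∷ q) =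
  trans (cong suc (∣p∪q∣+∣p∩q∣≡∣p∣+∣q∣ p q)) (sym (+-suc _ _))
∣p∪q∣+∣p∩q∣≡∣p∣+∣q∣ (false ∷ p) (false ∷ q) = ∣p∪q∣+∣p∩q∣≡∣p∣+∣q∣ p q

∣p∣≡∣p∩q∣+∣p─q∣ : ∀ {k} (p q : Subset k) → ∣ p ∣ ≡ ∣ p ∩ q ∣ + ∣ p ─ q ∣
∣p∣≡∣p∩q∣+∣p─q∣ []          []          = refl
∣p∣≡∣p∩q∣+∣p─q∣ (true  ∷ p) (true  ∷ q) = cong suc (∣p∣≡∣p∩q∣+∣p─q∣ p q)
∣p∣≡∣p∩q∣+∣p─q∣ (true  ∷ p) (false ∷ q) = trans (cong suc (∣p∣≡∣p∩q∣+∣p─q∣ p q)) (sym (+-suc _ _))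
∣p∣≡∣p∩q∣+∣p─q∣ (false ∷ p) (true  ∷ q) = ∣p∣≡∣p∩q∣+∣p─q∣ p q
∣p∣≡∣p∩q∣+∣p─q∣ (false ∷ p) (false ∷ q) = ∣p∣≡∣p∩q∣+∣p─q∣ p q

∣p∣≤suc∣p-x∣ : ∀ {k} (p : Subset k) x → ∣ p ∣ ≤ suc ∣ p - x ∣
∣p∣≤suc∣p-x∣ p x = begin
  ∣ p ∣                       ≡⟨ ∣p∣≡∣p∩q∣+∣p─q∣ p ⁅ x ⁆ ⟩
  ∣ p ∩ ⁅ x ⁆ ∣ + ∣ p - x ∣   ≤⟨ +-monoˡ-≤ _ (∣p∩q∣≤∣q∣ p ⁅ x ⁆) ⟩
  ∣ ⁅ x ⁆ ∣ + ∣ p - x ∣       ≡⟨ cong (_+ ∣ p - x ∣) (∣⁅x⁆∣≡1 x) ⟩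
  suc ∣ p - x ∣               ∎
  where open ≤-Reasoning

Empty⇒∣p∣≡0 : ∀ {k} {p : Subset k} → Empty p → ∣ p ∣ ≡ 0
Empty⇒∣p∣≡0 {k} empty = trans (cong ∣_∣ (Empty-unique empty)) (∣⊥∣≡0 k)

Nonempty⇒∣p∣>0 : ∀ {k} {p : Subset k} → Nonempty p → 0 < ∣ p ∣
Nonempty⇒∣p∣>0 (x , x∈p) = <-≤-trans (s≤s z≤n) (x∈p⇒∣p-x∣<∣p∣ x∈p)

minimum-size : ∀ {k ℓ} {P : Pred (Subset k) ℓ} → Decidable P →
               ∀ {S} → P S → ∃[ T ] (P T × (∀ {R} → P R → ∣ T ∣ ≤ ∣ R ∣))
minimum-size {P = P} P? {S} pS = go (suc ∣ S ∣) pS ≤-refl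
  where
  go : ∀ fuel {S} → P S → ∣ S ∣ < fuel → ∃[ T ] (P T × (∀ {R} → P R → ∣ T ∣ ≤ ∣ R ∣))
  go (suc fuel) {S} pS S<fuel with anySubset? (λ R → P? R ×-dec ∣ R ∣ <? ∣ S ∣)
  ... | yes (R , pR , R<S) = go fuel pR (<-≤-trans R<S (≤-pred S<fuel))
  ... | no none            = S , pS , λ pR → ≮⇒≥ (λ R<S → none (_ , pR , R<S))

x∈⁅y⁆∪⁅z⁆⁻ : ∀ {k} {x y z : Fin k} → x ∈ ⁅ y ⁆ ∪ ⁅ z ⁆ → x ≡ y ⊎ x ≡ z
x∈⁅y⁆∪⁅z⁆⁻ {y = y} {z} x∈ with x∈p∪q⁻ ⁅ y ⁆ ⁅ z ⁆ x∈
... | inj₁ x∈⁅y⁆ = inj₁ (x∈⁅y⁆⇒x≡y y x∈⁅y⁆)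
... | inj₂ x∈⁅z⁆ = inj₂ (x∈⁅y⁆⇒x≡y z x∈⁅z⁆)

x∈⁅x⁆∪⁅y⁆ : ∀ {k} {x y : Fin k} → x ∈ ⁅ x ⁆ ∪ ⁅ y ⁆
x∈⁅x⁆∪⁅y⁆ {x = x} = x∈p∪q⁺ (inj₁ (x∈⁅x⁆ x))

y∈⁅x⁆∪⁅y⁆ : ∀ {k} {x y : Fin k} → y ∈ ⁅ x ⁆ ∪ ⁅ y ⁆
y∈⁅x⁆∪⁅y⁆ {y = y} = x∈p∪q⁺ (inj₂ (x∈⁅x⁆ y))

x∉⁅y⁆∪⁅z⁆ : ∀ {k} {x y z : Fin k} → x ≢ y → x ≢ z → x ∉ ⁅ y ⁆ ∪ ⁅ z ⁆
x∉⁅y⁆∪⁅z⁆ x≢y x≢z x∈ = [ x≢y , x≢z ]′ (x∈⁅y⁆∪⁅z⁆⁻ x∈)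

p△⁅x⁆∪⁅x⁆≡p∪⁅x⁆ : ∀ {k} {p : Subset k} {x} → x ∉ p → (p △ (⁅ x ⁆ ∪ ⁅ x ⁆)) ≡ p ∪ ⁅ x ⁆
p△⁅x⁆∪⁅x⁆≡p∪⁅x⁆ {p = p} {x} x∉p = ⊆-antisym to from
  where
  to : (p △ (⁅ x ⁆ ∪ ⁅ x ⁆)) ⊆ p ∪ ⁅ x ⁆
  to z∈ with x∈p△q⁻ p _ z∈
  ... | inj₁ (z∈p , _) = x∈p∪q⁺ (inj₁ z∈p)
  ... | inj₂ (_ , z∈P) with x∈⁅y⁆∪⁅z⁆⁻ z∈P
  ...   | inj₁ refl = x∈p∪q⁺ (inj₂ (x∈⁅x⁆ x))
  ...   | inj₂ refl = x∈p∪q⁺ (inj₂ (x∈⁅x⁆ x))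
  from : p ∪ ⁅ x ⁆ ⊆ (p △ (⁅ x ⁆ ∪ ⁅ x ⁆))
  from z∈ with x∈p∪q⁻ p ⁅ x ⁆ z∈
  ... | inj₁ z∈p = x∈p△q⁺ (inj₁ (z∈p , x∉⁅y⁆∪⁅z⁆ z≢x z≢x))
    where
    z≢x : _ ≢ x
    z≢x refl = x∉p z∈p
  ... | inj₂ z∈⁅x⁆ with x∈⁅y⁆⇒x≡y x z∈⁅x⁆
  ...   | refl = x∈p△q⁺ (inj₂ (x∉p , x∈⁅x⁆∪⁅y⁆))

p△⁅x⁆∪⁅x⁆≡p-x : ∀ {k} {p : Subset k} {x} → x ∈ p → (p △ (⁅ x ⁆ ∪ ⁅ x ⁆)) ≡ p - x
p△⁅x⁆∪⁅x⁆≡p-x {p = p} {x} x∈p = ⊆-antisym to from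
  where
  to : (p △ (⁅ x ⁆ ∪ ⁅ x ⁆)) ⊆ p - x
  to z∈ with x∈p△q⁻ p _ z∈
  ... | inj₁ (z∈p , z∉P) = x∈p∧x≢y⇒x∈p-y z∈p λ { refl → z∉P x∈⁅x⁆∪⁅y⁆ }
  ... | inj₂ (z∉p , z∈P) with x∈⁅y⁆∪⁅z⁆⁻ z∈P
  ...   | inj₁ refl = ⊥-elim (z∉p x∈p)
  ...   | inj₂ refl = ⊥-elim (z∉p x∈p)
  from : p - x ⊆ (p △ (⁅ x ⁆ ∪ ⁅ x ⁆))
  from z∈ with x∈p-y⁻ z∈
  ... | z∈p , z≢x = x∈p△q⁺ (inj₁ (z∈p , x∉⁅y⁆∪⁅z⁆ z≢x z≢x))

p△⁅x⁆∪⁅y⁆≡p∪⁅x⁆-y : ∀ {k} {p : Subset k} {x y} → x ∉ p → y ∈ p →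
                     (p △ (⁅ x ⁆ ∪ ⁅ y ⁆)) ≡ p ∪ ⁅ x ⁆ - y
p△⁅x⁆∪⁅y⁆≡p∪⁅x⁆-y {p = p} {x} {y} x∉p y∈p = ⊆-antisym to from
  where
  to : (p △ (⁅ x ⁆ ∪ ⁅ y ⁆)) ⊆ p ∪ ⁅ x ⁆ - y
  to z∈ with x∈p△q⁻ p _ z∈
  ... | inj₁ (z∈p , z∉P) = x∈p∧x≢y⇒x∈p-y (x∈p∪q⁺ (inj₁ z∈p)) λ { refl → z∉P y∈⁅x⁆∪⁅y⁆ }
  ... | inj₂ (z∉p , z∈P) with x∈⁅y⁆∪⁅z⁆⁻ z∈P
  ...   | inj₁ refl = x∈p∧x≢y⇒x∈p-y (x∈p∪q⁺ (inj₂ (x∈⁅x⁆ x))) λ { refl → z∉p y∈p }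
  ...   | inj₂ refl = ⊥-elim (z∉p y∈p)
  from : p ∪ ⁅ x ⁆ - y ⊆ (p △ (⁅ x ⁆ ∪ ⁅ y ⁆))
  from z∈ with x∈p-y⁻ z∈
  ... | z∈p∪⁅x⁆ , z≢y with x∈p∪q⁻ p ⁅ x ⁆ z∈p∪⁅x⁆
  ...   | inj₁ z∈p = x∈p△q⁺ (inj₁ (z∈p , x∉⁅y⁆∪⁅z⁆ (λ { refl → x∉p z∈p }) z≢y))
  ...   | inj₂ z∈⁅x⁆ with x∈⁅y⁆⇒x≡y x z∈⁅x⁆
  ...     | refl = x∈p△q⁺ (inj₂ (x∉p , x∈⁅x⁆∪⁅y⁆))

p△⁅x⁆∪⁅y⁆≡p-x∪⁅y⁆ : ∀ {k} {p : Subset k} {x y} → x ∈ p → y ∉ p →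
                     (p △ (⁅ x ⁆ ∪ ⁅ y ⁆)) ≡ (p - x) ∪ ⁅ y ⁆
p△⁅x⁆∪⁅y⁆≡p-x∪⁅y⁆ {p = p} {x} {y} x∈p y∉p = ⊆-antisym to from
  where
  to : (p △ (⁅ x ⁆ ∪ ⁅ y ⁆)) ⊆ (p - x) ∪ ⁅ y ⁆
  to z∈ with x∈p△q⁻ p _ z∈
  ... | inj₁ (z∈p , z∉P) = x∈p∪q⁺ (inj₁ (x∈p∧x≢y⇒x∈p-y z∈p λ { refl → z∉P x∈⁅x⁆∪⁅y⁆ }))
  ... | inj₂ (z∉p , z∈P) with x∈⁅y⁆∪⁅z⁆⁻ z∈P
  ...   | inj₁ refl = ⊥-elim (z∉p x∈p)
  ...   | inj₂ refl = x∈p∪q⁺ (inj₂ (x∈⁅x⁆ y))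
  from : (p - x) ∪ ⁅ y ⁆ ⊆ (p △ (⁅ x ⁆ ∪ ⁅ y ⁆))
  from z∈ with x∈p∪q⁻ (p - x) ⁅ y ⁆ z∈
  ... | inj₁ z∈p-x with x∈p-y⁻ z∈p-x
  ...   | z∈p , z≢x = x∈p△q⁺ (inj₁ (z∈p , x∉⁅y⁆∪⁅z⁆ z≢x λ { refl → y∉p z∈p }))
  from z∈ | inj₂ z∈⁅y⁆ with x∈⁅y⁆⇒x≡y y z∈⁅y⁆
  ...   | refl = x∈p△q⁺ (inj₂ (y∉p , y∈⁅x⁆∪⁅y⁆))

module _ (G : Graph) where
  open Graph G

  private
    edges : List (Fin m)
    edges = Vec.toList (allFin m)

  x∈endSet⁻ : ∀ {e w} → w ∈ endSet G e → w ≡ proj₁ (ends e) ⊎ w ≡ proj₂ (ends e)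
  x∈endSet⁻ = x∈⁅y⁆∪⁅z⁆⁻

  ∈V⁻ : ∀ {F w} → w ∈ V G F → ∃[ e ] (e ∈ F × w ∈ endSet G e)
  ∈V⁻ {F} w∈ with x∈⋃⁻ (map (endSet G) (filter (_∈? F) edges)) w∈
  ... | s , s∈ , w∈s with ∈-map∘filter⁻ (endSet G) (_∈? F) {xs = edges} s∈
  ...   | e , _ , refl , e∈F = e , e∈F , w∈s

  ∈V⁺ : ∀ {F w e} → e ∈ F → w ∈ endSet G e → w ∈ V G F
  ∈V⁺ {F} {e = e} e∈F w∈ =
    x∈⋃⁺ (∈-map∘filter⁺ (endSet G) (_∈? F) (e , ∈-toList⁺ (∈-allFin⁺ e) , refl , e∈F)) w∈

  end₁∈endSet : ∀ e → proj₁ (ends e) ∈ endSet G e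
  end₁∈endSet e = x∈⁅x⁆∪⁅y⁆

  end₂∈endSet : ∀ e → proj₂ (ends e) ∈ endSet G e
  end₂∈endSet e = y∈⁅x⁆∪⁅y⁆

  V-mono : ∀ {F F′} → F ⊆ F′ → V G F ⊆ V G F′
  V-mono F⊆F′ w∈ with ∈V⁻ w∈
  ... | e , e∈F , w∈e = ∈V⁺ (F⊆F′ e∈F) w∈e

  V-∪ : ∀ R S → V G (R ∪ S) ⊆ V G R ∪ V G S
  V-∪ R S w∈ with ∈V⁻ w∈
  ... | e , e∈R∪S , w∈e with x∈p∪q⁻ R S e∈R∪S
  ...   | inj₁ e∈R = x∈p∪q⁺ (inj₁ (∈V⁺ e∈R w∈e))
  ...   | inj₂ e∈S = x∈p∪q⁺ (inj₂ (∈V⁺ e∈S w∈e))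

  V-∩ : ∀ R S → V G (R ∩ S) ⊆ V G R ∩ V G S
  V-∩ R S w∈ = x∈p∩q⁺ (V-mono (p∩q⊆p R S) w∈ , V-mono (p∩q⊆q R S) w∈)

  V-submodular : ∀ R S → ∣ V G (R ∪ S) ∣ + ∣ V G (R ∩ S) ∣ ≤ ∣ V G R ∣ + ∣ V G S ∣
  V-submodular R S = begin
    ∣ V G (R ∪ S) ∣ + ∣ V G (R ∩ S) ∣      ≤⟨ +-mono-≤ (p⊆q⇒∣p∣≤∣q∣ (V-∪ R S)) (p⊆q⇒∣p∣≤∣q∣ (V-∩ R S)) ⟩
    ∣ V G R ∪ V G S ∣ + ∣ V G R ∩ V G S ∣  ≡⟨ ∣p∪q∣+∣p∩q∣≡∣p∣+∣q∣ (V G R) (V G S) ⟩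
    ∣ V G R ∣ + ∣ V G S ∣                  ∎
    where open ≤-Reasoning

  ∣V∣≥2 : ∀ {F} → Nonempty F → 2 ≤ ∣ V G F ∣
  ∣V∣≥2 (e , e∈F) = ≤-trans (s≤s (Nonempty⇒∣p∣>0 (_ , v∈V-u))) (x∈p⇒∣p-x∣<∣p∣ u∈V)
    where
    u∈V : proj₁ (ends e) ∈ V G _
    u∈V = ∈V⁺ e∈F (end₁∈endSet e)
    v∈V-u : proj₂ (ends e) ∈ V G _ - proj₁ (ends e)
    v∈V-u = x∈p∧x≢y⇒x∈p-y (∈V⁺ e∈F (end₂∈endSet e)) (≢-sym (loopless e))

  -- Sparsity

  Violating : EdgeSet G → Set
  Violating S = Nonempty S × 2 * ∣ V G S ∣ < ∣ S ∣ + 3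

  violating? : Decidable Violating
  violating? S = nonempty? S ×-dec (2 * ∣ V G S ∣ <? ∣ S ∣ + 3)

  overBraced? : ∀ F → Dec (OverBraced G F)
  overBraced? F = anySubset? (λ S → S ⊆? F ×-dec violating? S)

  Sparse : ℕ → EdgeSet G → Set
  Sparse k F = ∀ {S} → S ⊆ F → Nonempty S → ∣ S ∣ + k ≤ 2 * ∣ V G S ∣

  ¬overBraced-⊆ : ∀ {F F′} → F ⊆ F′ → ¬ OverBraced G F′ → ¬ OverBraced G F
  ¬overBraced-⊆ F⊆F′ ind (S , S⊆F , vS) = ind (S , ⊆-trans S⊆F F⊆F′ , vS)

  ¬overBraced⇒sparse : ∀ {F} → ¬ OverBraced G F → Sparse 3 F
  ¬overBraced⇒sparse ind S⊆F neS = ≮⇒≥ λ lt → ind (_ , S⊆F , neS , lt)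

  sparse-⊆ : ∀ {k F F′} → F ⊆ F′ → Sparse k F′ → Sparse k F
  sparse-⊆ F⊆F′ sp S⊆F = sp (⊆-trans S⊆F F⊆F′)

  sparse-weaken : ∀ {k F} → Sparse (suc k) F → Sparse k F
  sparse-weaken {k} sp S⊆F neS = ≤-trans (+-monoʳ-≤ _ (n≤1+n k)) (sp S⊆F neS)

  sparse-∪⁅⁆ : ∀ {F x} → Sparse 3 F → Sparse 2 (F ∪ ⁅ x ⁆)
  sparse-∪⁅⁆ {F} {x} sp {A} A⊆ neA with nonempty? (A - x)
  ... | yes neA-x = begin
    ∣ A ∣ + 2            ≤⟨ +-monoˡ-≤ 2 (∣p∣≤suc∣p-x∣ A x) ⟩
    suc ∣ A - x ∣ + 2    ≡⟨ sym (+-suc ∣ A - x ∣ 2) ⟩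
    ∣ A - x ∣ + 3        ≤⟨ sp (p⊆q∪⁅x⁆⇒p-x⊆q A⊆) neA-x ⟩
    2 * ∣ V G (A - x) ∣  ≤⟨ *-monoʳ-≤ 2 (p⊆q⇒∣p∣≤∣q∣ (V-mono (p─q⊆p A ⁅ x ⁆))) ⟩
    2 * ∣ V G A ∣        ∎
    where open ≤-Reasoning
  ... | no A-x-empty = begin
    ∣ A ∣ + 2            ≤⟨ +-monoˡ-≤ 2 (∣p∣≤suc∣p-x∣ A x) ⟩
    suc ∣ A - x ∣ + 2    ≡⟨ cong (λ k → suc k + 2) (Empty⇒∣p∣≡0 A-x-empty) ⟩
    3                    ≤⟨ n≤1+n 3 ⟩
    2 * 2                ≤⟨ *-monoʳ-≤ 2 (∣V∣≥2 neA) ⟩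
    2 * ∣ V G A ∣        ∎
    where open ≤-Reasoning

  sparse-bound : ∀ {A U} → Sparse 2 A → V G A ⊆ U → Nonempty U → ∣ A ∣ + 2 ≤ 2 * ∣ U ∣
  sparse-bound {A} {U} sp VA⊆U neU with nonempty? A
  ... | yes neA = ≤-trans (sp ⊆-refl neA) (*-monoʳ-≤ 2 (p⊆q⇒∣p∣≤∣q∣ VA⊆U))
  ... | no A-empty = begin
    ∣ A ∣ + 2  ≡⟨ cong (_+ 2) (Empty⇒∣p∣≡0 A-empty) ⟩
    2 * 1      ≤⟨ *-monoʳ-≤ 2 (Nonempty⇒∣p∣>0 neU) ⟩
    2 * ∣ U ∣  ∎
    where open ≤-Reasoning

  violating-∩ : ∀ {H R S} → Sparse 2 H → R ⊆ H → S ⊆ H → Violating R → Violating S →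
                Nonempty (R ∩ S) → Violating (R ∩ S)
  violating-∩ {R = R} {S} sp R⊆H S⊆H (neR , vR) (_ , vS) neR∩S =
    neR∩S , ≤+2⇒<+3 (+-cancelˡ-≤ (∣ R ∪ S ∣ + 2) _ _ (begin
      (∣ R ∪ S ∣ + 2) + 2 * ∣ V G (R ∩ S) ∣      ≤⟨ +-monoˡ-≤ (2 * ∣ V G (R ∩ S) ∣) (sp R∪S⊆H neR∪S) ⟩
      2 * ∣ V G (R ∪ S) ∣ + 2 * ∣ V G (R ∩ S) ∣  ≡⟨ sym (*-distribˡ-+ 2 ∣ V G (R ∪ S) ∣ ∣ V G (R ∩ S) ∣) ⟩
      2 * (∣ V G (R ∪ S) ∣ + ∣ V G (R ∩ S) ∣)    ≤⟨ *-monoʳ-≤ 2 (V-submodular R S) ⟩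
      2 * (∣ V G R ∣ + ∣ V G S ∣)                ≡⟨ *-distribˡ-+ 2 ∣ V G R ∣ ∣ V G S ∣ ⟩
      2 * ∣ V G R ∣ + 2 * ∣ V G S ∣              ≤⟨ +-mono-≤ (<+3⇒≤+2 vR) (<+3⇒≤+2 vS) ⟩
      (∣ R ∣ + 2) + (∣ S ∣ + 2)                  ≡⟨ [a+2]+[b+2]≡[a+b]+4 ∣ R ∣ ∣ S ∣ ⟩
      (∣ R ∣ + ∣ S ∣) + 4                        ≡⟨ cong (_+ 4) (sym (∣p∪q∣+∣p∩q∣≡∣p∣+∣q∣ R S)) ⟩
      (∣ R ∪ S ∣ + ∣ R ∩ S ∣) + 4                ≡⟨ sym ([a+2]+[b+2]≡[a+b]+4 ∣ R ∪ S ∣ ∣ R ∩ S ∣) ⟩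
      (∣ R ∪ S ∣ + 2) + (∣ R ∩ S ∣ + 2)          ∎))
    where
    open ≤-Reasoning
    R∪S⊆H : R ∪ S ⊆ _
    R∪S⊆H z∈ = [ R⊆H , S⊆H ]′ (x∈p∪q⁻ R S z∈)
    neR∪S : Nonempty (R ∪ S)
    neR∪S = proj₁ neR , x∈p∪q⁺ (inj₁ (proj₂ neR))

  -- Cuts and connectivity

  -- A cut is encoded as a non-constant two-colouring of the vertices, so that two cuts
  -- can be combined pointwise by xor.

  Monochromatic : (Fin n → Bool) → Fin m → Set
  Monochromatic c e = c (proj₁ (ends e)) ≡ c (proj₂ (ends e))

  monochromatic? : ∀ c e → Dec (Monochromatic c e)
  monochromatic? c e = c (proj₁ (ends e)) Bool.≟ c (proj₂ (ends e))

  NonConstant : (Fin n → Bool) → Set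
  NonConstant c = ∃[ a ] ∃[ b ] c a ≢ c b

  Cut : EdgeSet G → Set
  Cut F = ∃[ c ] ((∀ {e} → e ∈ F → Monochromatic c e) × NonConstant c)

  colour-endpoint : ∀ {c e w} → Monochromatic c e → w ∈ endSet G e → c w ≡ c (proj₁ (ends e))
  colour-endpoint mono w∈ with x∈endSet⁻ w∈
  ... | inj₁ refl = refl
  ... | inj₂ refl = sym mono

  bichromatic-endpoint : ∀ {c e} → ¬ Monochromatic c e → ∀ b → ∃[ w ] (w ∈ endSet G e × c w ≡ b)
  bichromatic-endpoint {c} {e} bi b with c (proj₁ (ends e)) Bool.≟ b
  ... | yes cu≡b = _ , end₁∈endSet e , cu≡b
  ... | no  cu≢b = _ , end₂∈endSet e , trans (¬-not (≢-sym bi)) (sym (¬-not (≢-sym cu≢b)))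

  V-colour : ∀ {c b S} → (∀ {e} → e ∈ S → Monochromatic c e × c (proj₁ (ends e)) ≡ b) →
             ∀ {w} → w ∈ V G S → c w ≡ b
  V-colour side w∈ with ∈V⁻ w∈
  ... | e , e∈S , w∈e = trans (colour-endpoint (proj₁ (side e∈S)) w∈e) (proj₂ (side e∈S))

  -- Split R ∖ {y} by the colour of the edges' first endpoints: each part lies in one colour
  -- class of V(R), and the endpoints of y make both classes nonempty.
  cut-sparse : ∀ c {R y} → y ∈ R → ¬ Monochromatic c y →
               (∀ {e} → e ∈ R - y → Monochromatic c e) → Sparse 2 (R - y) →
               ∣ R ∣ + 3 ≤ 2 * ∣ V G R ∣
  cut-sparse c {R} {y} y∈R y-bi mono sp = begin
    ∣ R ∣ + 3                                ≤⟨ +-monoˡ-≤ 3 (∣p∣≤suc∣p-x∣ R y) ⟩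
    suc ∣ R - y ∣ + 3                        ≡⟨ cong (λ k → suc k + 3) (∣p∣≡∣p∩q∣+∣p─q∣ (R - y) E) ⟩
    suc (∣ A ∣ + ∣ B ∣) + 3                  ≡⟨ sym (+-suc (∣ A ∣ + ∣ B ∣) 3) ⟩
    (∣ A ∣ + ∣ B ∣) + 4                      ≡⟨ sym ([a+2]+[b+2]≡[a+b]+4 ∣ A ∣ ∣ B ∣) ⟩
    (∣ A ∣ + 2) + (∣ B ∣ + 2)                ≤⟨ +-mono-≤ (sparse-bound (sparse-⊆ A⊆ sp) VA⊆ neU₁)
                                                         (sparse-bound (sparse-⊆ B⊆ sp) VB⊆ neU₂) ⟩
    2 * ∣ V G R ∩ Z ∣ + 2 * ∣ V G R ─ Z ∣    ≡⟨ sym (*-distribˡ-+ 2 ∣ V G R ∩ Z ∣ ∣ V G R ─ Z ∣) ⟩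
    2 * (∣ V G R ∩ Z ∣ + ∣ V G R ─ Z ∣)      ≡⟨ cong (2 *_) (sym (∣p∣≡∣p∩q∣+∣p─q∣ (V G R) Z)) ⟩
    2 * ∣ V G R ∣                            ∎
    where
    open ≤-Reasoning
    Z : Subset n
    Z = tabulate c
    E A B : EdgeSet G
    E = tabulate (λ e → c (proj₁ (ends e)))
    A = (R - y) ∩ E
    B = (R - y) ─ E
    A⊆ : A ⊆ R - y
    A⊆ = p∩q⊆p (R - y) E
    B⊆ : B ⊆ R - y
    B⊆ = p─q⊆p (R - y) E
    R-y⊆R : R - y ⊆ R
    R-y⊆R = p─q⊆p R ⁅ y ⁆

    VA⊆ : V G A ⊆ V G R ∩ Z
    VA⊆ w∈ = x∈p∩q⁺ (V-mono (⊆-trans A⊆ R-y⊆R) w∈ , x∈tabulate⁺ (V-colour side w∈))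
      where
      side : ∀ {e} → e ∈ A → Monochromatic c e × c (proj₁ (ends e)) ≡ true
      side e∈A = mono (A⊆ e∈A) , x∈tabulate⁻ (proj₂ (x∈p∩q⁻ (R - y) E e∈A))

    VB⊆ : V G B ⊆ V G R ─ Z
    VB⊆ w∈ = x∈p∧x∉q⇒x∈p─q (V-mono (⊆-trans B⊆ R-y⊆R) w∈) (x∉tabulate⁺ (V-colour side w∈))
      where
      side : ∀ {e} → e ∈ B → Monochromatic c e × c (proj₁ (ends e)) ≡ false
      side e∈B = mono (B⊆ e∈B) , x∉tabulate⁻ (proj₂ (x∈p─q⁻ (R - y) E e∈B))

    neU₁ : Nonempty (V G R ∩ Z)
    neU₁ with bichromatic-endpoint y-bi true
    ... | w , w∈y , cw = w , x∈p∩q⁺ (∈V⁺ y∈R w∈y , x∈tabulate⁺ cw)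

    neU₂ : Nonempty (V G R ─ Z)
    neU₂ with bichromatic-endpoint y-bi false
    ... | w , w∈y , cw = w , x∈p∧x∉q⇒x∈p─q (∈V⁺ y∈R w∈y) (x∉tabulate⁺ cw)

  adj-sym : ∀ {F u v} → Adj G F u v → Adj G F v u
  adj-sym (e , e∈F , inj₁ e≡uv) = e , e∈F , inj₂ e≡uv
  adj-sym (e , e∈F , inj₂ e≡vu) = e , e∈F , inj₁ e≡vu

  connected-mono : ∀ {F F′} → F ⊆ F′ → Connected G F → Connected G F′
  connected-mono F⊆F′ conn u v = Star.map (λ (e , e∈F , j) → e , F⊆F′ e∈F , j) (conn u v)

  adj-colour : ∀ {F c u v} → (∀ {e} → e ∈ F → Monochromatic c e) → Adj G F u v → c u ≡ c v
  adj-colour {c = c} mono (e , e∈F , inj₁ e≡uv) =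
    subst (λ (p , q) → c p ≡ c q) e≡uv (mono e∈F)
  adj-colour {c = c} mono (e , e∈F , inj₂ e≡vu) =
    sym (subst (λ (p , q) → c p ≡ c q) e≡vu (mono e∈F))

  connected⇒constant : ∀ {F} c → Connected G F → (∀ {e} → e ∈ F → Monochromatic c e) →
                       ∀ a b → c a ≡ c b
  connected⇒constant c conn mono a b =
    Star.fold (λ u v → c u ≡ c v) (λ adj → trans (adj-colour mono adj)) refl (conn a b)

  connected⇒¬cut : ∀ {F} → Connected G F → ¬ Cut F
  connected⇒¬cut conn (c , mono , a , b , ca≢cb) = ca≢cb (connected⇒constant c conn mono a b)

  crossing-edge : ∀ c {F} → Connected G F → NonConstant c → ∃[ e ] (e ∈ F × ¬ Monochromatic c e)
  crossing-edge c {F} conn (a , b , ca≢cb) with any? (λ e → e ∈? F ×-dec ¬? (monochromatic? c e))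
  ... | yes found = found
  ... | no  none  = ⊥-elim (ca≢cb (connected⇒constant c conn mono a b))
    where
    mono : ∀ {e} → e ∈ F → Monochromatic c e
    mono {e} e∈F = decidable-stable (monochromatic? c e) λ bi → none (e , e∈F , bi)

  sole-crossing : ∀ c {F x} → Connected G F → (∀ {e} → e ∈ F - x → Monochromatic c e) →
                  NonConstant c → ¬ Monochromatic c x
  sole-crossing c {F} {x} conn mono (a , b , ca≢cb) x-mono =
    ca≢cb (connected⇒constant c conn monoF a b)
    where
    monoF : ∀ {e} → e ∈ F → Monochromatic c e
    monoF {e} e∈F with e ≟ x
    ... | yes refl = x-mono
    ... | no  e≢x  = mono (x∈p∧x≢y⇒x∈p-y e∈F e≢x)

  leaving-edge : ∀ {F R e} → e ∈ F → ¬ Monochromatic (lookup R) e →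
                 ∃[ i ] ∃[ o ] (i ∈ R × o ∉ R × Adj G F i o)
  leaving-edge {R = R} {e} e∈F bi with lookup R (proj₁ (ends e)) in eq
  ... | true  = _ , _ , lookup⇒[]= _ R eq , (λ v∈R → bi (sym ([]=⇒lookup v∈R))) , e , e∈F , inj₁ refl
  ... | false = _ , _ , lookup⇒[]= _ R (¬-not (bi ∘ sym)) , lookup≡false⇒∉ eq , e , e∈F , inj₂ refl

  -- Breadth-first search from r: R is grown along edges of F leaving it, and when no edge
  -- leaves R, either R contains every vertex or lookup R is a cut. Each step enlarges R, so
  -- n steps of fuel suffice.
  module _ (F : EdgeSet G) (r : Fin n) where

    explore : ∀ fuel R → r ∈ R → (∀ {w} → w ∈ R → Star (Adj G F) r w) → n ≤ ∣ R ∣ + fuel →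
              Connected G F ⊎ Cut F
    explore fuel R r∈R reach bound with any? (λ e → e ∈? F ×-dec ¬? (monochromatic? (lookup R) e))
    ... | yes (e , e∈F , bi) with leaving-edge e∈F bi
    ...   | i , o , i∈R , o∉R , adj = extend fuel bound
      where
      R′ : Subset n
      R′ = R ∪ ⁅ o ⁆
      grows : ∣ R ∣ < ∣ R′ ∣
      grows = p⊂q⇒∣p∣<∣q∣ (p⊆p∪q ⁅ o ⁆ , o , x∈p∪q⁺ (inj₂ (x∈⁅x⁆ o)) , o∉R)
      reach′ : ∀ {w} → w ∈ R′ → Star (Adj G F) r w
      reach′ w∈ with x∈p∪q⁻ R ⁅ o ⁆ w∈
      ... | inj₁ w∈R = reach w∈R
      ... | inj₂ w∈⁅o⁆ rewrite x∈⁅y⁆⇒x≡y o w∈⁅o⁆ = reach i∈R ◅◅ adj ◅ ε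
      extend : ∀ fuel → n ≤ ∣ R ∣ + fuel → Connected G F ⊎ Cut F
      extend zero bound =
        ⊥-elim (<⇒≱ (<-≤-trans grows (∣p∣≤n R′)) (subst (n ≤_) (+-identityʳ ∣ R ∣) bound))
      extend (suc fuel) bound = explore fuel R′ (x∈p∪q⁺ (inj₁ r∈R)) reach′ (begin
        n                   ≤⟨ bound ⟩
        ∣ R ∣ + suc fuel    ≡⟨ +-suc ∣ R ∣ fuel ⟩
        suc ∣ R ∣ + fuel    ≤⟨ +-monoˡ-≤ fuel grows ⟩
        ∣ R′ ∣ + fuel       ∎)
        where open ≤-Reasoning
    explore fuel R r∈R reach bound | no none with any? (λ w → ¬? (w ∈? R))
    ...   | yes (b , b∉R) =
      inj₂ (lookup R , mono , r , b , λ eq → b∉R (lookup⇒[]= b R (trans (sym eq) ([]=⇒lookup r∈R))))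
      where
      mono : ∀ {e} → e ∈ F → Monochromatic (lookup R) e
      mono {e} e∈F = decidable-stable (monochromatic? (lookup R) e) λ bi → none (e , e∈F , bi)
    ...   | no allIn = inj₁ λ u v → Star.reverse adj-sym (reach (inR u)) ◅◅ reach (inR v)
      where
      inR : ∀ w → w ∈ R
      inR w = decidable-stable (w ∈? R) λ w∉R → allIn (w , w∉R)

  connected-or-cut : ∀ F → Connected G F ⊎ Cut F
  connected-or-cut F with any? {P = λ _ → ⊤} (λ _ → yes tt)
  ... | yes (r , _) = explore F r n ⁅ r ⁆ (x∈⁅x⁆ r) reach
                        (≤-trans (m≤n+m n 1) (≤-reflexive (cong (_+ n) (sym (∣⁅x⁆∣≡1 r)))))
    where
    reach : ∀ {w} → w ∈ ⁅ r ⁆ → Star (Adj G F) r w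
    reach w∈ rewrite x∈⁅y⁆⇒x≡y r w∈ = ε
  ... | no noVertex = inj₁ λ u _ → ⊥-elim (noVertex (u , tt))

  ¬cut⇒connected : ∀ {F} → ¬ Cut F → Connected G F
  ¬cut⇒connected {F} ¬cut = [ id , ⊥-elim ∘ ¬cut ]′ (connected-or-cut F)

  connected? : ∀ F → Dec (Connected G F)
  connected? F = [ yes , (λ cut → no λ conn → connected⇒¬cut conn cut) ]′ (connected-or-cut F)

  -- Spanning trees

  Joins : Fin m → Fin n → Fin n → Set
  Joins e u v = ends e ≡ (u , v) ⊎ ends e ≡ (v , u)

  joins-unique : ∀ {e u v p q} → Joins e u v → Joins e p q → (p ≡ u × q ≡ v) ⊎ (p ≡ v × q ≡ u)
  joins-unique (inj₁ e≡uv) (inj₁ e≡pq) = inj₁ (,-injective (trans (sym e≡pq) e≡uv))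
  joins-unique (inj₁ e≡uv) (inj₂ e≡qp) = inj₂ (swap (,-injective (trans (sym e≡qp) e≡uv)))
  joins-unique (inj₂ e≡vu) (inj₁ e≡pq) = inj₂ (,-injective (trans (sym e≡pq) e≡vu))
  joins-unique (inj₂ e≡vu) (inj₂ e≡qp) = inj₁ (swap (,-injective (trans (sym e≡qp) e≡vu)))

  adj-avoiding : ∀ {T e v w p q} → Joins e v w → Adj G T p q → p ≢ v → p ≢ w → Adj G (T - e) p q
  adj-avoiding j (g , g∈T , jg) p≢v p≢w = g , x∈p∧x≢y⇒x∈p-y g∈T g≢e , jg
    where
    g≢e : g ≢ _
    g≢e refl = [ p≢v ∘ proj₁ , p≢w ∘ proj₁ ]′ (joins-unique j jg)

  walk-avoiding : ∀ {T e v w} → Joins e v w → ∀ {p} ps →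
                  All (λ z → z ≢ v × z ≢ w) (p ∷ ps) → Linked (Adj G T) (p ∷ (ps ∷ʳ v)) →
                  Star (Adj G (T - e)) p v
  walk-avoiding j []       ((p≢v , p≢w) ∷ []) (adj ∷ [-])  = adj-avoiding j adj p≢v p≢w ◅ ε
  walk-avoiding j (_ ∷ ps) ((p≢v , p≢w) ∷ ok) (adj ∷ adjs) =
    adj-avoiding j adj p≢v p≢w ◅ walk-avoiding j ps ok adjs

  adj-without : ∀ {T e v w} → Joins e v w → Star (Adj G (T - e)) v w →
                ∀ {p q} → Adj G T p q → Star (Adj G (T - e)) p q
  adj-without {e = e} j path (g , g∈T , jg) with g ≟ e
  ... | no g≢e = (g , x∈p∧x≢y⇒x∈p-y g∈T g≢e , jg) ◅ ε
  ... | yes refl with joins-unique j jg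
  ...   | inj₁ (refl , refl) = path
  ...   | inj₂ (refl , refl) = Star.reverse adj-sym path

  connected-without : ∀ {T e v w} → Joins e v w → Star (Adj G (T - e)) v w →
                      Connected G T → Connected G (T - e)
  connected-without j path conn u u′ = Star.kleisliStar id (adj-without j path) (conn u u′)

  cycle⇒removable : ∀ {T} → Connected G T → HasCycle G T → ∃[ e ] (e ∈ T × Connected G (T - e))
  cycle⇒removable conn (v , [] , () , _)
  cycle⇒removable conn (v , _ ∷ [] , s≤s () , _)
  cycle⇒removable conn (v , w ∷ w′ ∷ ws , _ , v∉ ∷ w∉ ∷ _ , (e , e∈T , j) ∷ adj ∷ adjs) =
    e , e∈T , connected-without j (Star.reverse adj-sym path) conn
    where
    avoid : All (λ z → z ≢ v × z ≢ w) (w′ ∷ ws)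
    avoid = All.zipWith (λ (v≢z , w≢z) → ≢-sym v≢z , ≢-sym w≢z) (All.tail v∉ , w∉)
    path : Star (Adj G (_ - e)) w v
    path = adj-sym (adj-avoiding j (adj-sym adj) (proj₁ (All.head avoid)) (proj₂ (All.head avoid)))
           ◅ walk-avoiding j ws avoid adjs

  containsSpanningTree⇒connected : ∀ {F} → ContainsSpanningTree G F → Connected G F
  containsSpanningTree⇒connected (T , T⊆F , connT , _) = connected-mono T⊆F connT

  connected⇒containsSpanningTree : ∀ {F} → Connected G F → ContainsSpanningTree G F
  connected⇒containsSpanningTree {F} conn
    with minimum-size (λ T → T ⊆? F ×-dec connected? T) (⊆-refl , conn)
  ... | T , (T⊆F , connT) , minimal = T , T⊆F , connT , acyclic
    where
    acyclic : ¬ HasCycle G T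
    acyclic cycle with cycle⇒removable connT cycle
    ... | e , e∈T , connT-e =
      <⇒≱ (x∈p⇒∣p-x∣<∣p∣ e∈T) (minimal (⊆-trans (p─q⊆p T ⁅ e ⁆) T⊆F , connT-e))

  -- Exchange

  ¬overBraced-∪-crossing : ∀ c {F y} → ¬ OverBraced G F → (∀ {e} → e ∈ F → Monochromatic c e) →
                           ¬ Monochromatic c y → ¬ OverBraced G (F ∪ ⁅ y ⁆)
  ¬overBraced-∪-crossing c {F} {y} ind mono y-bi (R , R⊆ , neR , vR) with y ∈? R
  ... | no  y∉R = ind (R , p⊆q∪⁅x⁆∧x∉p⇒p⊆q R⊆ y∉R , neR , vR)
  ... | yes y∈R = <⇒≱ vR (cut-sparse c y∈R y-bi (λ e∈ → mono (R-y⊆F e∈))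
                                    (sparse-weaken (sparse-⊆ R-y⊆F (¬overBraced⇒sparse ind))))
    where
    R-y⊆F : R - y ⊆ F
    R-y⊆F = p⊆q∪⁅x⁆⇒p-x⊆q R⊆

  connected-swap-across-cut : ∀ c {F x y} → Connected G F → (∀ {e} → e ∈ F - x → Monochromatic c e) →
                              ¬ Monochromatic c y → Connected G ((F - x) ∪ ⁅ y ⁆)
  connected-swap-across-cut c {F} {x} {y} conn mono y-bi = ¬cut⇒connected ¬cut
    where
    -- Both c and a cut c′ of the new set are crossed by x alone among the edges of F, so
    -- no edge of F crosses c xor c′, which is therefore constant; but y crosses c and not c′.
    ¬cut : ¬ Cut ((F - x) ∪ ⁅ y ⁆)
    ¬cut (c′ , mono′ , c′-nonconstant) =
      xor-≢-≡ y-bi (mono′ (x∈p∪q⁺ (inj₂ (x∈⁅x⁆ y)))) (connected⇒constant W conn monoW _ _)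
      where
      W : Fin n → Bool
      W w = c w xor c′ w
      monoW : ∀ {e} → e ∈ F → Monochromatic W e
      monoW {e} e∈F with e ≟ x
      ... | yes refl = xor-≢-≢ (sole-crossing c conn mono (_ , _ , y-bi))
                               (sole-crossing c′ conn (λ e∈ → mono′ (x∈p∪q⁺ (inj₁ e∈))) c′-nonconstant)
      ... | no  e≢x  = cong₂ _xor_ (mono e∈F-x) (mono′ (x∈p∪q⁺ (inj₁ e∈F-x)))
        where
        e∈F-x : e ∈ F - x
        e∈F-x = x∈p∧x≢y⇒x∈p-y e∈F e≢x

  connected-remove-from-violating : ∀ {H S y} → Connected G H → Sparse 2 H → S ⊆ H →
                                    Violating S → y ∈ S → Connected G (H - y)
  connected-remove-from-violating {S = S} conn sp S⊆H (_ , vS) y∈S =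
    ¬cut⇒connected λ (c , mono , c-nonconstant) →
      <⇒≱ vS (cut-sparse c y∈S (sole-crossing c conn mono c-nonconstant)
                         (λ e∈ → mono (p⊆q⇒p-x⊆q-x S⊆H e∈)) (sparse-⊆ (⊆-trans (p─q⊆p S _) S⊆H) sp))

  violating-∋ : ∀ {F x S} → ¬ OverBraced G F → S ⊆ F ∪ ⁅ x ⁆ → Violating S → x ∈ S
  violating-∋ {x = x} {S} ind S⊆ vS =
    decidable-stable (x ∈? S) λ x∉S → ind (S , p⊆q∪⁅x⁆∧x∉p⇒p⊆q S⊆ x∉S , vS)

  ¬overBraced-remove-from-minimum :
    ∀ {F x S y} → ¬ OverBraced G F → S ⊆ F ∪ ⁅ x ⁆ → Violating S →
    (∀ {R} → R ⊆ F ∪ ⁅ x ⁆ × Violating R → ∣ S ∣ ≤ ∣ R ∣) → y ∈ S →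
    ¬ OverBraced G (F ∪ ⁅ x ⁆ - y)
  ¬overBraced-remove-from-minimum {x = x} {S} {y} ind S⊆H vS minimal y∈S (R , R⊆H-y , vR) =
    <⇒≱ (p⊂q⇒∣p∣<∣q∣ (p∩q⊆q R S , y , y∈S , y∉R∩S)) (minimal (⊆-trans (p∩q⊆p R S) R⊆H , vR∩S))
    where
    R⊆H : R ⊆ _
    R⊆H = ⊆-trans R⊆H-y (p─q⊆p _ ⁅ y ⁆)
    y∉R∩S : y ∉ R ∩ S
    y∉R∩S y∈ = proj₂ (x∈p-y⁻ (R⊆H-y (proj₁ (x∈p∩q⁻ R S y∈)))) refl
    vR∩S : Violating (R ∩ S)
    vR∩S = violating-∩ (sparse-∪⁅⁆ (¬overBraced⇒sparse ind)) R⊆H S⊆H vR vS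
             (x , x∈p∩q⁺ (violating-∋ ind R⊆H vR , violating-∋ ind S⊆H vS))

  inF : ∀ {F} → Connected G F → ¬ OverBraced G F → InF G F
  inF conn ind = connected⇒containsSpanningTree conn , ind

  exchange-insert : ∀ {F₁ F₂ x} → Connected G F₁ → ¬ OverBraced G F₁ → ¬ OverBraced G F₂ → x ∈ F₂ →
                    InF G (F₁ ∪ ⁅ x ⁆) ⊎ ∃[ y ] (y ∈ F₁ × y ∉ F₂ × InF G (F₁ ∪ ⁅ x ⁆ - y))
  exchange-insert {F₁} {x = x} conn₁ ind₁ ind₂ x∈F₂ with overBraced? (F₁ ∪ ⁅ x ⁆)
  ... | no ind = inj₁ (inF (connected-mono (p⊆p∪q ⁅ x ⁆) conn₁) ind)
  ... | yes (S₀ , S₀⊆H , vS₀)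
    with minimum-size (λ S → S ⊆? F₁ ∪ ⁅ x ⁆ ×-dec violating? S) (S₀⊆H , vS₀)
  ...   | S , (S⊆H , vS) , minimal with p⊈q⇒∃ (λ S⊆F₂ → ind₂ (S , S⊆F₂ , vS))
  ...     | y , y∈S , y∉F₂ =
    inj₂ (y , y∈F₁ , y∉F₂ , inF (connected-remove-from-violating connH sparseH S⊆H vS y∈S)
                                (¬overBraced-remove-from-minimum ind₁ S⊆H vS minimal y∈S))
    where
    connH : Connected G (F₁ ∪ ⁅ x ⁆)
    connH = connected-mono (p⊆p∪q ⁅ x ⁆) conn₁
    sparseH : Sparse 2 (F₁ ∪ ⁅ x ⁆)
    sparseH = sparse-∪⁅⁆ (¬overBraced⇒sparse ind₁)
    y∈F₁ : y ∈ F₁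
    y∈F₁ = p⊆q∪⁅x⁆⇒p-x⊆q S⊆H (x∈p∧x≢y⇒x∈p-y y∈S λ { refl → y∉F₂ x∈F₂ })

  exchange-delete : ∀ {F₁ F₂ x} → Connected G F₁ → ¬ OverBraced G F₁ → Connected G F₂ → x ∉ F₂ →
                    InF G (F₁ - x) ⊎ ∃[ y ] (y ∉ F₁ × y ∈ F₂ × InF G ((F₁ - x) ∪ ⁅ y ⁆))
  exchange-delete {F₁} {x = x} conn₁ ind₁ conn₂ x∉F₂ with connected-or-cut (F₁ - x)
  ... | inj₁ conn = inj₁ (inF conn (¬overBraced-⊆ (p─q⊆p F₁ ⁅ x ⁆) ind₁))
  ... | inj₂ (c , mono , c-nonconstant) with crossing-edge c conn₂ c-nonconstant
  ...   | y , y∈F₂ , y-bi =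
    inj₂ (y , y∉F₁ , y∈F₂ , inF (connected-swap-across-cut c conn₁ mono y-bi)
                                (¬overBraced-∪-crossing c ind₁-x mono y-bi))
    where
    ind₁-x : ¬ OverBraced G (F₁ - x)
    ind₁-x = ¬overBraced-⊆ (p─q⊆p F₁ ⁅ x ⁆) ind₁
    y∉F₁ : y ∉ F₁
    y∉F₁ y∈F₁ = y-bi (mono (x∈p∧x≢y⇒x∈p-y y∈F₁ λ { refl → x∉F₂ y∈F₂ }))

theorem2p1 : (G : Graph) → ConnectedGraph G →
    ∀ (F₁ F₂ : EdgeSet G) → InF G F₁ → InF G F₂ →
    ∀ x → x ∈ (F₁ △ F₂) →
    ∃[ y ] (y ∈ (F₁ △ F₂) × InF G (F₁ △ (⁅ x ⁆ ∪ ⁅ y ⁆)))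
theorem2p1 G _ F₁ F₂ (T₁ , ind₁) (T₂ , ind₂) x x∈F₁△F₂ with x∈p△q⁻ F₁ F₂ x∈F₁△F₂
... | inj₁ (x∈F₁ , x∉F₂)
  with exchange-delete G (containsSpanningTree⇒connected G T₁) ind₁
                         (containsSpanningTree⇒connected G T₂) x∉F₂
...   | inj₁ ok = x , x∈F₁△F₂ , subst (InF G) (sym (p△⁅x⁆∪⁅x⁆≡p-x x∈F₁)) ok
...   | inj₂ (y , y∉F₁ , y∈F₂ , ok) =
  y , x∈p△q⁺ (inj₂ (y∉F₁ , y∈F₂)) , subst (InF G) (sym (p△⁅x⁆∪⁅y⁆≡p-x∪⁅y⁆ x∈F₁ y∉F₁)) ok
theorem2p1 G _ F₁ F₂ (T₁ , ind₁) (T₂ , ind₂) x x∈F₁△F₂ | inj₂ (x∉F₁ , x∈F₂)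
  with exchange-insert G (containsSpanningTree⇒connected G T₁) ind₁ ind₂ x∈F₂
...   | inj₁ ok = x , x∈F₁△F₂ , subst (InF G) (sym (p△⁅x⁆∪⁅x⁆≡p∪⁅x⁆ x∉F₁)) ok
...   | inj₂ (y , y∈F₁ , y∉F₂ , ok) =
  y , x∈p△q⁺ (inj₁ (y∈F₁ , y∉F₂)) , subst (InF G) (sym (p△⁅x⁆∪⁅y⁆≡p∪⁅x⁆-y x∉F₁ y∈F₁)) ok
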